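{- For integers $a,b,c$ the following are equivalent: (a) $\operatorname{bal}(\mathrm{diag}(a,b,c))=1$; (b) there exist integers $x,y,z$ with $x+y+z=1$ and $ax+by+cz=\frac13(a+b+c)$; (c) $\nu_3(a+b-2c)\ge1+\min(\nu_3(a-c),\nu_3(b-c))$.
   Context: $\nu_3$ is the 3-adic valuation with $\nu_3(0)=\infty$. For $D\in\mathbb{Z}^{3\times3}$ and $\sigma\in S_3$, $(D^\sigma)_{ij}=D_{\sigma(i)\sigma(j)}$; $\operatorname{bal}(D)$ is the least positive value of $\sum_\sigma c_\sigma$ over integer families with $\sum_\sigma c_\sigma D^\sigma\in\{pI+qJ:p,q\in\mathbb{Z}\}$. -}

module Defs where

open import Data.Nat as ℕ using (ℕ; zero; suc)
open import Data.Nat.DivMod using (_%_; _/_)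
open import Data.Integer as ℤ using (ℤ; +_; _+_; _*_; ∣_∣)
open import Data.Fin using (Fin; zero; suc)
open import Data.Bool using (Bool; true; false; if_then_else_)
open import Data.Product using (Σ; ∃; _×_; _,_)
open import Relation.Binary.PropositionalEquality using (_≡_)
open import Relation.Nullary using (¬_; yes; no)
import Data.Fin

data ℕ∞ : Set where
  fin : ℕ → ℕ∞
  ∞   : ℕ∞

data _≤∞_ : ℕ∞ → ℕ∞ → Set where
  fin≤fin : ∀ {m n} → m ℕ.≤ n → fin m ≤∞ fin n
  _≤∞∞    : ∀ x → x ≤∞ ∞

min∞ : ℕ∞ → ℕ∞ → ℕ∞
min∞ (fin m) (fin n) = fin (ℕ._⊓_ m n)
min∞ (fin m) ∞       = fin m
min∞ ∞       y       = y

1+∞ : ℕ∞ → ℕ∞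
1+∞ (fin n) = fin (suc n)
1+∞ ∞       = ∞

-- number of factors 3 in n, with fuel (fuel n suffices for n ≥ 1, since 3^k ≤ n)
val3 : ℕ → ℕ → ℕ
val3 zero    n = 0
val3 (suc f) n with n % 3
... | zero  = suc (val3 f (n / 3))
... | suc _ = 0

ν₃ : ℤ → ℕ∞
ν₃ x with ∣ x ∣
... | zero  = ∞
... | suc m = fin (val3 (suc m) (suc m))

Mat : Set
Mat = Fin 3 → Fin 3 → ℤ

S₃ : Fin 6 → (Fin 3 → Fin 3)
S₃ zero                            i = i
S₃ (suc zero)                      zero = suc zero
S₃ (suc zero)                      (suc zero) = zero
S₃ (suc zero)                      (suc (suc zero)) = suc (suc zero)
S₃ (suc (suc zero))                zero = suc (suc zero)
S₃ (suc (suc zero))                (suc zero) = suc zero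
S₃ (suc (suc zero))                (suc (suc zero)) = zero
S₃ (suc (suc (suc zero)))          zero = zero
S₃ (suc (suc (suc zero)))          (suc zero) = suc (suc zero)
S₃ (suc (suc (suc zero)))          (suc (suc zero)) = suc zero
S₃ (suc (suc (suc (suc zero))))    zero = suc zero
S₃ (suc (suc (suc (suc zero))))    (suc zero) = suc (suc zero)
S₃ (suc (suc (suc (suc zero))))    (suc (suc zero)) = zero
S₃ (suc (suc (suc (suc (suc zero))))) zero = suc (suc zero)
S₃ (suc (suc (suc (suc (suc zero))))) (suc zero) = zero
S₃ (suc (suc (suc (suc (suc zero))))) (suc (suc zero)) = suc zero

_^σ_ : Mat → (Fin 3 → Fin 3) → Mat
(D ^σ σ) i j = D (σ i) (σ j)

sum6 : (Fin 6 → ℤ) → ℤ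
sum6 f = f zero + (f (suc zero) + (f (suc (suc zero)) + (f (suc (suc (suc zero)))
         + (f (suc (suc (suc (suc zero)))) + f (suc (suc (suc (suc (suc zero)))))))))

combo : (Fin 6 → ℤ) → Mat → Mat
combo c D i j = sum6 (λ k → c k * (D ^σ S₃ k) i j)

δ : Fin 3 → Fin 3 → ℤ
δ i j with i Data.Fin.≟ j
... | yes _ = + 1
... | no _  = + 0

-- M ∈ {pI + qJ : p,q ∈ ℤ}  (J = all-ones matrix)
InIJ : Mat → Set
InIJ M = ∃ λ p → ∃ λ q → ∀ i j → M i j ≡ p * δ i j + q

Attained : Mat → ℤ → Set
Attained D n = ∃ λ (c : Fin 6 → ℤ) → InIJ (combo c D) × sum6 c ≡ n

Bal : Mat → ℕ → Set
Bal D n = (0 ℕ.< n) × Attained D (+ n) × (∀ m → 0 ℕ.< m → Attained D (+ m) → n ℕ.≤ m)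

diag : ℤ → ℤ → ℤ → Mat
diag a b c zero zero = a
diag a b c (suc zero) (suc zero) = b
diag a b c (suc (suc zero)) (suc (suc zero)) = c
diag a b c zero (suc _) = + 0
diag a b c (suc _) zero = + 0
diag a b c (suc zero) (suc (suc _)) = + 0
diag a b c (suc (suc _)) (suc zero) = + 0

-- The diagonal entries of Σ c_σ D^σ for D = diag(a,b,c) are combinations ax + by + cz
-- with x + y + z = Σ c_σ, and their sum is (Σ c_σ)(a + b + c).  So a family with Σ c_σ = 1
-- landing in span(I,J), whose diagonal is constant, yields (b); conversely (b) is realised
-- by a family whose diagonal weights are (x,y,z), (x,y,z) and (1-2x, 1-2y, 1-2z).
-- Eliminating z, (b) says that (a-c) + (b-c) lies in 3((a-c)ℤ + (b-c)ℤ) = 3gℤ for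
-- g = gcd(a-c, b-c).  As g divides (a-c) + (b-c) anyway, this holds iff ν₃ of the sum
-- exceeds ν₃(g) = min(ν₃(a-c), ν₃(b-c)).
module Submission where

open import Defs
open import Data.Integer using (ℤ; +_; _+_; _-_; _*_)
open import Data.Product using (∃; _×_)
open import Relation.Binary.PropositionalEquality using (_≡_)
open import Function.Bundles using (_⇔_)

open import Data.Empty using (⊥-elim)
open import Data.Fin using (Fin; zero; suc; _≟_)
open import Data.Integer using (-_; ∣_∣)
import Data.Integer.Properties as ℤ
import Data.Integer.Divisibility.Signed as ℤ∣
open import Data.Integer.Tactic.RingSolver using (solve-∀)
open import Data.Nat as ℕ using (zero; suc; _^_; z≤n; s≤s)
import Data.Nat.Properties as ℕ
open import Data.Nat.DivMod using (_%_; _/_; m*[n/m]≡n; m/n<m)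
open import Data.Nat.Divisibility
  using (_∣_; divides; _∣0; 0∣⇒≡0; 1∣_; ∣-trans; m∣m*n; *-monoʳ-∣; *-monoˡ-∣; *-cancelˡ-∣; m%n≡0⇒n∣m; n∣m⇒m%n≡0)
open import Data.Nat.GCD using (gcd; gcd[m,n]∣m; gcd[m,n]∣n; gcd-GCD; module Bézout)
open import Data.Nat.Primality using (prime?; euclidsLemma)
import Data.Nat.Tactic.RingSolver as ℕ-Ring
open import Data.Product using (∃₂; _,_)
open import Data.Sum using (inj₁; inj₂; [_,_]′)
open import Function.Base using (_∘_)
open import Function.Bundles using (mk⇔; module Equivalence)
open import Function.Properties.Equivalence using () renaming (trans to ⇔-trans; sym to ⇔-sym)
open import Relation.Binary.PropositionalEquality using (refl; sym; trans; cong; cong₂; subst; subst₂; _≢_; module ≡-Reasoning)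
open import Relation.Nullary using (¬_; yes; no)
open import Relation.Nullary.Decidable using (from-yes)

open ≡-Reasoning

-- Condition (b), with the factor 1/3 cleared.
MeanAttained : ℤ → ℤ → ℤ → Set
MeanAttained a b c = ∃ λ x → ∃ λ y → ∃ λ z → (x + y + z ≡ + 1) × (+ 3 * (a * x + b * y + c * z) ≡ a + b + c)

trace : Mat → ℤ
trace M = M zero zero + M (suc zero) (suc zero) + M (suc (suc zero)) (suc (suc zero))

trace-combo : ∀ C D → trace (combo C D) ≡ sum6 C * trace D
trace-combo C D = identity (C zero) (C (suc zero)) (C (suc (suc zero))) (C (suc (suc (suc zero))))
  (C (suc (suc (suc (suc zero))))) (C (suc (suc (suc (suc (suc zero))))))
  (D zero zero) (D (suc zero) (suc zero)) (D (suc (suc zero)) (suc (suc zero)))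
  where
  identity : ∀ c₀ c₁ c₂ c₃ c₄ c₅ d₀ d₁ d₂ →
    (c₀ * d₀ + (c₁ * d₁ + (c₂ * d₂ + (c₃ * d₀ + (c₄ * d₁ + c₅ * d₂)))))
    + (c₀ * d₁ + (c₁ * d₀ + (c₂ * d₁ + (c₃ * d₂ + (c₄ * d₂ + c₅ * d₀)))))
    + (c₀ * d₂ + (c₁ * d₂ + (c₂ * d₀ + (c₃ * d₁ + (c₄ * d₀ + c₅ * d₁)))))
    ≡ (c₀ + (c₁ + (c₂ + (c₃ + (c₄ + c₅))))) * (d₀ + d₁ + d₂)
  identity = solve-∀

trace-InIJ : ∀ {M} → InIJ M → trace M ≡ + 3 * M zero zero
trace-InIJ {M} (p , q , M≡pI+qJ) = begin
  M₀₀ + M (suc zero) (suc zero) + M (suc (suc zero)) (suc (suc zero))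
    ≡⟨ cong₂ (λ m₁₁ m₂₂ → M₀₀ + m₁₁ + m₂₂)
         (trans (M≡pI+qJ (suc zero) (suc zero)) (sym M₀₀≡p+q))
         (trans (M≡pI+qJ (suc (suc zero)) (suc (suc zero))) (sym M₀₀≡p+q)) ⟩
  M₀₀ + M₀₀ + M₀₀
    ≡⟨ triple M₀₀ ⟩
  + 3 * M₀₀ ∎
  where
  M₀₀ = M zero zero
  M₀₀≡p+q : M₀₀ ≡ p * + 1 + q
  M₀₀≡p+q = M≡pI+qJ zero zero
  triple : ∀ e → e + e + e ≡ + 3 * e
  triple = solve-∀

scalar∈IJ : ∀ {M} s → (∀ i → M i i ≡ s) → (∀ {i j} → i ≢ j → M i j ≡ + 0) → InIJ M
scalar∈IJ {M} s M-diag M-offDiag = s , + 0 , entry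
  where
  entry : ∀ i j → M i j ≡ s * δ i j + + 0
  entry i j with i ≟ j
  ... | yes refl = trans (M-diag i) (sym (trans (ℤ.+-identityʳ _) (ℤ.*-identityʳ s)))
  ... | no i≢j   = trans (M-offDiag i≢j) (sym (trans (ℤ.+-identityʳ _) (ℤ.*-zeroʳ s)))

sum6-*-zeroʳ : ∀ (C : Fin 6 → ℤ) → sum6 (λ k → C k * + 0) ≡ + 0
sum6-*-zeroʳ C = identity (C zero) (C (suc zero)) (C (suc (suc zero))) (C (suc (suc (suc zero))))
  (C (suc (suc (suc (suc zero))))) (C (suc (suc (suc (suc (suc zero))))))
  where
  identity : ∀ c₀ c₁ c₂ c₃ c₄ c₅ →
    c₀ * + 0 + (c₁ * + 0 + (c₂ * + 0 + (c₃ * + 0 + (c₄ * + 0 + c₅ * + 0)))) ≡ + 0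
  identity = solve-∀

combo-diag-offDiagonal : ∀ C a b c {i j} → i ≢ j → combo C (diag a b c) i j ≡ + 0
combo-diag-offDiagonal C a b c {zero}             {zero}             0≢0 = ⊥-elim (0≢0 refl)
combo-diag-offDiagonal C a b c {zero}             {suc zero}         _   = sum6-*-zeroʳ C
combo-diag-offDiagonal C a b c {zero}             {suc (suc zero)}   _   = sum6-*-zeroʳ C
combo-diag-offDiagonal C a b c {suc zero}         {zero}             _   = sum6-*-zeroʳ C
combo-diag-offDiagonal C a b c {suc zero}         {suc zero}         1≢1 = ⊥-elim (1≢1 refl)
combo-diag-offDiagonal C a b c {suc zero}         {suc (suc zero)}   _   = sum6-*-zeroʳ C
combo-diag-offDiagonal C a b c {suc (suc zero)}   {zero}             _   = sum6-*-zeroʳ C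
combo-diag-offDiagonal C a b c {suc (suc zero)}   {suc zero}         _   = sum6-*-zeroʳ C
combo-diag-offDiagonal C a b c {suc (suc zero)}   {suc (suc zero)}   2≢2 = ⊥-elim (2≢2 refl)

Bal1⇔Attained1 : ∀ D → Bal D 1 ⇔ Attained D (+ 1)
Bal1⇔Attained1 D = mk⇔ (λ (_ , attained , _) → attained) (λ attained → s≤s z≤n , attained , λ _ 0<m _ → 0<m)

attained⇒meanAttained : ∀ a b c → Attained (diag a b c) (+ 1) → MeanAttained a b c
attained⇒meanAttained a b c (C , combo∈IJ , ΣC≡1) = x , y , z , trans (regroup c₀ c₁ c₂ c₃ c₄ c₅) ΣC≡1 , (begin
  + 3 * (a * x + b * y + c * z)      ≡⟨ cong (+ 3 *_) (first-entry a b c c₀ c₁ c₂ c₃ c₄ c₅) ⟨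
  + 3 * combo C D zero zero          ≡⟨ trace-InIJ combo∈IJ ⟨
  trace (combo C D)                  ≡⟨ trace-combo C D ⟩
  sum6 C * (a + b + c)               ≡⟨ cong (_* (a + b + c)) ΣC≡1 ⟩
  + 1 * (a + b + c)                  ≡⟨ ℤ.*-identityˡ _ ⟩
  a + b + c                          ∎)
  where
  D = diag a b c
  c₀ = C zero
  c₁ = C (suc zero)
  c₂ = C (suc (suc zero))
  c₃ = C (suc (suc (suc zero)))
  c₄ = C (suc (suc (suc (suc zero))))
  c₅ = C (suc (suc (suc (suc (suc zero)))))
  -- x, y, z collect the c_σ with σ(0) = 0, 1, 2 respectively.
  x = c₀ + c₃
  y = c₁ + c₄
  z = c₂ + c₅
  regroup : ∀ c₀ c₁ c₂ c₃ c₄ c₅ → (c₀ + c₃) + (c₁ + c₄) + (c₂ + c₅) ≡ c₀ + (c₁ + (c₂ + (c₃ + (c₄ + c₅))))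
  regroup = solve-∀
  first-entry : ∀ a b c c₀ c₁ c₂ c₃ c₄ c₅ →
    c₀ * a + (c₁ * b + (c₂ * c + (c₃ * a + (c₄ * b + c₅ * c)))) ≡ a * (c₀ + c₃) + b * (c₁ + c₄) + c * (c₂ + c₅)
  first-entry = solve-∀

-- Σ c_σ diag(a,b,c)^σ for this family has diagonal entries with weights (x,y,z), (x,y,z)
-- and (y+z-x, x+z-y, x+y-z) on (a,b,c).
balancingFamily : ℤ → ℤ → ℤ → Fin 6 → ℤ
balancingFamily x y z zero                                  = + 0
balancingFamily x y z (suc zero)                            = x + y - z
balancingFamily x y z (suc (suc zero))                      = y
balancingFamily x y z (suc (suc (suc zero)))                = x
balancingFamily x y z (suc (suc (suc (suc zero))))          = z - x
balancingFamily x y z (suc (suc (suc (suc (suc zero)))))    = z - y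

meanAttained⇒attained : ∀ a b c → MeanAttained a b c → Attained (diag a b c) (+ 1)
meanAttained⇒attained a b c (x , y , z , x+y+z≡1 , 3s≡a+b+c) =
  C , scalar∈IJ s diagonal (combo-diag-offDiagonal C a b c) , trans (total x y z) x+y+z≡1
  where
  C = balancingFamily x y z
  s = a * x + b * y + c * z
  total : ∀ x y z → + 0 + (x + y - z + (y + (x + (z - x + (z - y))))) ≡ x + y + z
  total = solve-∀
  entry₀ : ∀ a b c x y z →
    + 0 * a + ((x + y - z) * b + (y * c + (x * a + ((z - x) * b + (z - y) * c)))) ≡ a * x + b * y + c * z
  entry₀ = solve-∀
  entry₁ : ∀ a b c x y z →
    + 0 * b + ((x + y - z) * a + (y * b + (x * c + ((z - x) * c + (z - y) * a)))) ≡ a * x + b * y + c * z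
  entry₁ = solve-∀
  entry₂ : ∀ a b c x y z →
    + 0 * c + ((x + y - z) * c + (y * a + (x * b + ((z - x) * a + (z - y) * b))))
      ≡ (a + b + c) * (x + y + z) - + 2 * (a * x + b * y + c * z)
  entry₂ = solve-∀
  3s-2s : ∀ s → + 3 * s * + 1 - + 2 * s ≡ s
  3s-2s = solve-∀
  diagonal : ∀ i → combo C (diag a b c) i i ≡ s
  diagonal zero             = entry₀ a b c x y z
  diagonal (suc zero)       = entry₁ a b c x y z
  diagonal (suc (suc zero)) = begin
    combo C (diag a b c) (suc (suc zero)) (suc (suc zero)) ≡⟨ entry₂ a b c x y z ⟩
    (a + b + c) * (x + y + z) - + 2 * s                    ≡⟨ cong₂ (λ t u → t * u - + 2 * s) (sym 3s≡a+b+c) x+y+z≡1 ⟩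
    + 3 * s * + 1 - + 2 * s                                ≡⟨ 3s-2s s ⟩
    s                                                      ∎

attained⇔meanAttained : ∀ a b c → Attained (diag a b c) (+ 1) ⇔ MeanAttained a b c
attained⇔meanAttained a b c = mk⇔ (attained⇒meanAttained a b c) (meanAttained⇒attained a b c)

1+min≤∞⇔ : ∀ A B C → 1+∞ (min∞ A B) ≤∞ C ⇔ (∀ j → fin j ≤∞ A → fin j ≤∞ B → fin (suc j) ≤∞ C)
1+min≤∞⇔ A B C = mk⇔ (to A B C) (from A B C)
  where
  to : ∀ A B C → 1+∞ (min∞ A B) ≤∞ C → ∀ j → fin j ≤∞ A → fin j ≤∞ B → fin (suc j) ≤∞ C
  to A       B       ∞       _                   _ _             _             = _ ≤∞∞
  to (fin a) (fin b) (fin c) (fin≤fin 1+a⊓b≤c) _ (fin≤fin j≤a) (fin≤fin j≤b) = fin≤fin (ℕ.≤-trans (s≤s (ℕ.⊓-glb j≤a j≤b)) 1+a⊓b≤c)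
  to (fin a) ∞       (fin c) (fin≤fin 1+a≤c)   _ (fin≤fin j≤a) _             = fin≤fin (ℕ.≤-trans (s≤s j≤a) 1+a≤c)
  to ∞       (fin b) (fin c) (fin≤fin 1+b≤c)   _ _             (fin≤fin j≤b) = fin≤fin (ℕ.≤-trans (s≤s j≤b) 1+b≤c)
  from : ∀ A B C → (∀ j → fin j ≤∞ A → fin j ≤∞ B → fin (suc j) ≤∞ C) → 1+∞ (min∞ A B) ≤∞ C
  from A       B       ∞       _ = _ ≤∞∞
  from (fin a) (fin b) (fin c) h = h (a ℕ.⊓ b) (fin≤fin (ℕ.m⊓n≤m a b)) (fin≤fin (ℕ.m⊓n≤n a b))
  from (fin a) ∞       (fin c) h = h a (fin≤fin ℕ.≤-refl) (_ ≤∞∞)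
  from ∞       (fin b) (fin c) h = h b (_ ≤∞∞) (fin≤fin ℕ.≤-refl)
  from ∞       ∞       (fin c) h with h c (_ ≤∞∞) (_ ≤∞∞)
  ... | fin≤fin 1+c≤c = ⊥-elim (ℕ.n≮n c 1+c≤c)

3^∣⇔≤val3 : ∀ f m j → 0 ℕ.< m → m ℕ.≤ f → (3 ^ j ∣ m) ⇔ (j ℕ.≤ val3 f m)
3^∣⇔≤val3 zero    m j       0<m m≤0   = ⊥-elim (ℕ.n≮0 (ℕ.<-≤-trans 0<m m≤0))
3^∣⇔≤val3 (suc f) m zero    _   _     = mk⇔ (λ _ → z≤n) (λ _ → 1∣ m)
3^∣⇔≤val3 (suc f) m (suc j) 0<m m≤1+f with m % 3 in m%3≡r
... | zero  = ⇔-trans cancel-3 (⇔-trans (3^∣⇔≤val3 f k j 0<k k≤f) (mk⇔ s≤s ℕ.s≤s⁻¹))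
  where
  k = m / 3
  3k≡m : 3 ℕ.* k ≡ m
  3k≡m = m*[n/m]≡n (m%n≡0⇒n∣m m 3 m%3≡r)
  cancel-3 : (3 ^ suc j ∣ m) ⇔ (3 ^ j ∣ k)
  cancel-3 = subst (λ n → (3 ^ suc j ∣ n) ⇔ (3 ^ j ∣ k)) 3k≡m (mk⇔ (*-cancelˡ-∣ 3) (*-monoʳ-∣ 3))
  0<k : 0 ℕ.< k
  0<k = ℕ.n≢0⇒n>0 (λ k≡0 → ℕ.<⇒≢ 0<m (trans (cong (3 ℕ.*_) (sym k≡0)) 3k≡m))
  k≤f : k ℕ.≤ f
  k≤f = ℕ.s≤s⁻¹ (ℕ.<-≤-trans (m/n<m m 3 {{ℕ.>-nonZero 0<m}} (s≤s (s≤s z≤n))) m≤1+f)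
... | suc r = mk⇔ (⊥-elim ∘ 3∤m ∘ ∣-trans (m∣m*n (3 ^ j))) λ ()
  where
  3∤m : ¬ 3 ∣ m
  3∤m 3∣m = ℕ.1+n≢0 (trans (sym m%3≡r) (n∣m⇒m%n≡0 m 3 3∣m))

fin≤ν₃⇔3^∣ : ∀ n j → (fin j ≤∞ ν₃ n) ⇔ (3 ^ j ∣ ∣ n ∣)
fin≤ν₃⇔3^∣ n j with ∣ n ∣
... | zero  = mk⇔ (λ _ → (3 ^ j) ∣0) (λ _ → _ ≤∞∞)
... | suc m = mk⇔ (λ { (fin≤fin j≤ν) → from j≤ν }) (λ 3^j∣ → fin≤fin (to 3^j∣))
  where open Equivalence (3^∣⇔≤val3 (suc m) (suc m) j (s≤s z≤n) ℕ.≤-refl)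

maximal-3-power : ∀ d → 0 ℕ.< d → ∃ λ k → (3 ^ k ∣ d) × ¬ (3 ^ suc k ∣ d)
maximal-3-power d 0<d = k , from (valuation k) ℕ.≤-refl , ℕ.n≮n k ∘ to (valuation (suc k))
  where
  open Equivalence using (to; from)
  k = val3 d d
  valuation : ∀ j → (3 ^ j ∣ d) ⇔ (j ℕ.≤ k)
  valuation j = 3^∣⇔≤val3 d d j 0<d ℕ.≤-refl

3*∣-of-jump : ∀ d w → (∀ j → 3 ^ j ∣ d → 3 ^ suc j ∣ w) → d ∣ w → 3 ℕ.* d ∣ w
3*∣-of-jump zero      w _    0∣w              = subst (0 ∣_) (sym (0∣⇒≡0 0∣w)) (0 ∣0)
3*∣-of-jump d@(suc _) w jump (divides t w≡td) with maximal-3-power d (s≤s z≤n)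
... | k , 3^k∣d@(divides h d≡h3^k) , 3^1+k∤d =
  [ ⊥-elim ∘ 3∤h , 3∣t⇒3d∣w ]′ (euclidsLemma h t (from-yes (prime? 3)) 3∣ht)
  where
  3∤h : ¬ 3 ∣ h
  3∤h 3∣h = 3^1+k∤d (subst (3 ^ suc k ∣_) (sym d≡h3^k) (*-monoˡ-∣ (3 ^ k) 3∣h))
  w≡3^k[ht] : w ≡ 3 ^ k ℕ.* (h ℕ.* t)
  w≡3^k[ht] = trans w≡td (trans (cong (t ℕ.*_) d≡h3^k) (rearrange t h (3 ^ k)))
    where
    rearrange : ∀ t h p → t ℕ.* (h ℕ.* p) ≡ p ℕ.* (h ℕ.* t)
    rearrange = ℕ-Ring.solve-∀
  3∣ht : 3 ∣ h ℕ.* t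
  3∣ht = *-cancelˡ-∣ (3 ^ k) {{ℕ.m^n≢0 3 k}} (subst₂ _∣_ (ℕ.*-comm 3 (3 ^ k)) w≡3^k[ht] (jump k 3^k∣d))
  3∣t⇒3d∣w : 3 ∣ t → 3 ℕ.* d ∣ w
  3∣t⇒3d∣w 3∣t = subst (3 ℕ.* d ∣_) (sym w≡td) (*-monoˡ-∣ d 3∣t)

multiple-of-∣i∣ : ∀ x i → ∃ λ y → x * + ∣ i ∣ ≡ i * y
multiple-of-∣i∣ x i with ℤ.+∣i∣≡i⊎+∣i∣≡-i i
... | inj₁ ∣i∣≡i  = x , trans (cong (x *_) ∣i∣≡i) (ℤ.*-comm x i)
... | inj₂ ∣i∣≡-i = - x , trans (cong (x *_) ∣i∣≡-i) (swap-negation x i)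
  where
  swap-negation : ∀ x i → x * - i ≡ i * - x
  swap-negation = solve-∀

pos-bézout : ∀ {d m n} x y → d ℕ.+ y ℕ.* n ≡ x ℕ.* m → + d ≡ + x * + m - + y * + n
pos-bézout {d} {m} {n} x y d+yn≡xm = begin
  + d                               ≡⟨ cancel (+ d) (+ (y ℕ.* n)) ⟩
  + d + + (y ℕ.* n) - + (y ℕ.* n)   ≡⟨ cong (λ e → + e - + (y ℕ.* n)) d+yn≡xm ⟩
  + (x ℕ.* m) - + (y ℕ.* n)         ≡⟨ cong₂ _-_ (ℤ.pos-* x m) (ℤ.pos-* y n) ⟩
  + x * + m - + y * + n             ∎
  where
  cancel : ∀ i j → i ≡ i + j - j
  cancel = solve-∀

difference-of-abs-multiples : ∀ {g} u v x y → g ≡ + x * + ∣ u ∣ - + y * + ∣ v ∣ → ∃₂ λ X Y → g ≡ u * X + v * Y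
difference-of-abs-multiples u v x y g≡ with multiple-of-∣i∣ (+ x) u | multiple-of-∣i∣ (+ y) v
... | X , x∣u∣≡uX | Y , y∣v∣≡vY =
  X , - Y , trans g≡ (trans (cong₂ _-_ x∣u∣≡uX y∣v∣≡vY) (cong (λ e → u * X + e) (ℤ.neg-distribʳ-* v Y)))

bézout : ∀ u v → ∃₂ λ x y → + gcd ∣ u ∣ ∣ v ∣ ≡ u * x + v * y
bézout u v with Bézout.identity (gcd-GCD ∣ u ∣ ∣ v ∣)
... | Bézout.+- x y eq = difference-of-abs-multiples u v x y (pos-bézout x y eq)
... | Bézout.-+ x y eq with difference-of-abs-multiples v u y x (pos-bézout y x eq)
...   | Y , X , g≡vY+uX = X , Y , trans g≡vY+uX (ℤ.+-comm (v * Y) (u * X))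

-- Condition (c), with ν₃ read through divisibility: ν₃ w ≥ 1 + min (ν₃ u) (ν₃ v).
ValuationJump : ℤ → ℤ → ℤ → Set
ValuationJump u v w = ∀ j → 3 ^ j ∣ ∣ u ∣ → 3 ^ j ∣ ∣ v ∣ → 3 ^ suc j ∣ ∣ w ∣

3[ux+vy]≡u+v⇔jump : ∀ u v w → u + v ≡ w → (∃₂ λ x y → + 3 * (u * x + v * y) ≡ u + v) ⇔ ValuationJump u v w
3[ux+vy]≡u+v⇔jump u v _ refl = mk⇔ combination⇒jump jump⇒combination
  where
  ∣⇒ℤ∣ : ∀ {m} i → m ∣ ∣ i ∣ → + m ℤ∣.∣ i
  ∣⇒ℤ∣ _ = ℤ∣.∣ᵤ⇒∣
  combination⇒jump : (∃₂ λ x y → + 3 * (u * x + v * y) ≡ u + v) → ValuationJump u v (u + v)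
  combination⇒jump (x , y , 3[ux+vy]≡u+v) j 3^j∣u 3^j∣v =
    subst (3 ^ suc j ∣_) ∣3[ux+vy]∣≡∣u+v∣ (*-monoʳ-∣ 3 (ℤ∣.∣⇒∣ᵤ 3^j∣ux+vy))
    where
    3^j∣ux+vy : + (3 ^ j) ℤ∣.∣ u * x + v * y
    3^j∣ux+vy = ℤ∣.∣m∣n⇒∣m+n (ℤ∣.∣m⇒∣m*n x (∣⇒ℤ∣ u 3^j∣u)) (ℤ∣.∣m⇒∣m*n y (∣⇒ℤ∣ v 3^j∣v))
    ∣3[ux+vy]∣≡∣u+v∣ : 3 ℕ.* ∣ u * x + v * y ∣ ≡ ∣ u + v ∣
    ∣3[ux+vy]∣≡∣u+v∣ = trans (sym (ℤ.abs-* (+ 3) (u * x + v * y))) (cong ∣_∣ 3[ux+vy]≡u+v)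
  jump⇒combination : ValuationJump u v (u + v) → ∃₂ λ x y → + 3 * (u * x + v * y) ≡ u + v
  jump⇒combination jump with bézout u v | ∣⇒ℤ∣ (u + v) (3*∣-of-jump g ∣ u + v ∣ g-jump g∣u+v)
    where
    g = gcd ∣ u ∣ ∣ v ∣
    g-jump : ∀ j → 3 ^ j ∣ g → 3 ^ suc j ∣ ∣ u + v ∣
    g-jump j 3^j∣g = jump j (∣-trans 3^j∣g (gcd[m,n]∣m ∣ u ∣ ∣ v ∣)) (∣-trans 3^j∣g (gcd[m,n]∣n ∣ u ∣ ∣ v ∣))
    g∣u+v : g ∣ ∣ u + v ∣
    g∣u+v = ℤ∣.∣⇒∣ᵤ (ℤ∣.∣m∣n⇒∣m+n (∣⇒ℤ∣ u (gcd[m,n]∣m ∣ u ∣ ∣ v ∣)) (∣⇒ℤ∣ v (gcd[m,n]∣n ∣ u ∣ ∣ v ∣)))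
  ... | X , Y , g≡uX+vY | ℤ∣.divides s u+v≡s[3g] = X * s , Y * s , (begin
    + 3 * (u * (X * s) + v * (Y * s))  ≡⟨ factor u v X Y s ⟩
    s * (+ 3 * (u * X + v * Y))        ≡⟨ cong (λ e → s * (+ 3 * e)) g≡uX+vY ⟨
    s * (+ 3 * + gcd ∣ u ∣ ∣ v ∣)      ≡⟨ cong (s *_) (ℤ.pos-* 3 (gcd ∣ u ∣ ∣ v ∣)) ⟨
    s * + (3 ℕ.* gcd ∣ u ∣ ∣ v ∣)      ≡⟨ u+v≡s[3g] ⟨
    u + v                              ∎)
    where
    factor : ∀ u v X Y s → + 3 * (u * (X * s) + v * (Y * s)) ≡ s * (+ 3 * (u * X + v * Y))
    factor = solve-∀

jump⇔1+min≤ν₃ : ∀ u v w → ValuationJump u v w ⇔ (1+∞ (min∞ (ν₃ u) (ν₃ v)) ≤∞ ν₃ w)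
jump⇔1+min≤ν₃ u v w = ⇔-trans (mk⇔ jump⇒bounds bounds⇒jump) (⇔-sym (1+min≤∞⇔ (ν₃ u) (ν₃ v) (ν₃ w)))
  where
  open Equivalence using (to; from)
  jump⇒bounds : ValuationJump u v w → ∀ j → fin j ≤∞ ν₃ u → fin j ≤∞ ν₃ v → fin (suc j) ≤∞ ν₃ w
  jump⇒bounds jump j j≤u j≤v =
    from (fin≤ν₃⇔3^∣ w (suc j)) (jump j (to (fin≤ν₃⇔3^∣ u j) j≤u) (to (fin≤ν₃⇔3^∣ v j) j≤v))
  bounds⇒jump : (∀ j → fin j ≤∞ ν₃ u → fin j ≤∞ ν₃ v → fin (suc j) ≤∞ ν₃ w) → ValuationJump u v w
  bounds⇒jump bounds j 3^j∣u 3^j∣v =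
    to (fin≤ν₃⇔3^∣ w (suc j)) (bounds j (from (fin≤ν₃⇔3^∣ u j) 3^j∣u) (from (fin≤ν₃⇔3^∣ v j) 3^j∣v))

meanAttained⇔shifted : ∀ a b c →
  MeanAttained a b c ⇔ (∃₂ λ x y → + 3 * ((a - c) * x + (b - c) * y) ≡ (a - c) + (b - c))
meanAttained⇔shifted a b c = mk⇔ to from
  where
  to : MeanAttained a b c → ∃₂ λ x y → + 3 * ((a - c) * x + (b - c) * y) ≡ (a - c) + (b - c)
  to (x , y , z , x+y+z≡1 , 3s≡a+b+c) = x , y , (begin
    + 3 * ((a - c) * x + (b - c) * y)                          ≡⟨ eliminate-z a b c x y z ⟩
    + 3 * (a * x + b * y + c * z) - + 3 * c * (x + y + z)      ≡⟨ cong₂ (λ t u → t - + 3 * c * u) 3s≡a+b+c x+y+z≡1 ⟩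
    a + b + c - + 3 * c * + 1                                   ≡⟨ shift a b c ⟩
    (a - c) + (b - c)                                           ∎)
    where
    eliminate-z : ∀ a b c x y z →
      + 3 * ((a - c) * x + (b - c) * y) ≡ + 3 * (a * x + b * y + c * z) - + 3 * c * (x + y + z)
    eliminate-z = solve-∀
    shift : ∀ a b c → a + b + c - + 3 * c * + 1 ≡ (a - c) + (b - c)
    shift = solve-∀
  from : (∃₂ λ x y → + 3 * ((a - c) * x + (b - c) * y) ≡ (a - c) + (b - c)) → MeanAttained a b c
  from (x , y , 3s′≡a-c+b-c) = x , y , + 1 - x - y , sum≡1 x y , (begin
    + 3 * (a * x + b * y + c * (+ 1 - x - y))   ≡⟨ substitute-z a b c x y ⟩
    + 3 * ((a - c) * x + (b - c) * y) + + 3 * c ≡⟨ cong (_+ + 3 * c) 3s′≡a-c+b-c ⟩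
    (a - c) + (b - c) + + 3 * c                 ≡⟨ unshift a b c ⟩
    a + b + c                                   ∎)
    where
    sum≡1 : ∀ x y → x + y + (+ 1 - x - y) ≡ + 1
    sum≡1 = solve-∀
    substitute-z : ∀ a b c x y → + 3 * (a * x + b * y + c * (+ 1 - x - y)) ≡ + 3 * ((a - c) * x + (b - c) * y) + + 3 * c
    substitute-z = solve-∀
    unshift : ∀ a b c → (a - c) + (b - c) + + 3 * c ≡ a + b + c
    unshift = solve-∀

lemma2p5 : (a b c : ℤ) →
    (Bal (diag a b c) 1 ⇔ (∃ λ x → ∃ λ y → ∃ λ z → (x + y + z ≡ + 1) × (+ 3 * (a * x + b * y + c * z) ≡ a + b + c)))
    × ((∃ λ x → ∃ λ y → ∃ λ z → (x + y + z ≡ + 1) × (+ 3 * (a * x + b * y + c * z) ≡ a + b + c)) ⇔ (1+∞ (min∞ (ν₃ (a - c)) (ν₃ (b - c))) ≤∞ ν₃ (a + b - + 2 * c)))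
lemma2p5 a b c =
    ⇔-trans (Bal1⇔Attained1 (diag a b c)) (attained⇔meanAttained a b c)
  , ⇔-trans (meanAttained⇔shifted a b c)
      (⇔-trans (3[ux+vy]≡u+v⇔jump (a - c) (b - c) (a + b - + 2 * c) (shifted-sum a b c))
               (jump⇔1+min≤ν₃ (a - c) (b - c) (a + b - + 2 * c)))
  where
  shifted-sum : ∀ a b c → (a - c) + (b - c) ≡ a + b - + 2 * c
  shifted-sum = solve-∀
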